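{- Let $S,T$ be nonempty subsets of $[n-1]$ such that $A=T_n\langle S;T\rangle$ is a walk-ensured Toeplitz matrix. Then the matrix period of $A$ is $\gcd(S+T)/\gcd(S\cup T)$. Furthermore, if $\gcd(S+T)\le n$, then the graph sequence $\{C^m(D(A))\}_{m=1}^\infty$ converges (i.e., is eventually constant).
   Context: Matrices are Boolean ($0,1$ entries with $1+1=1$), and powers are Boolean matrix powers. For nonempty $S,T\subseteq[n-1]$, $T_n\langle S;T\rangle$ denotes the $n\times n$ $(0,1)$-matrix whose $(i,j)$-entry is $1$ if and only if $j-i\in S$ or $i-j\in T$. Its digraph $D(A)$ has vertex set $[n]$ and an arc $(i,j)$ exactly when the $(i,j)$-entry is $1$. $\gcd(S\cup T)$ is the gcd of all elements of $S\cup T$; $\gcd(S+T)=\gcd\{s+t: s\in S,t\in T\}$; $s_1=\min S$. The matrix $A$ is called walk-ensured if there is a positive integer $M$ such that for all vertices $u,v\in[n]$ and every integer $\ell\ge M$ with $v-u\equiv \ell s_1 \pmod{\gcd(S+T)}$, there is a directed walk from $u$ to $v$ of length $\ell$ in $D(A)$. The matrix period of a Boolean square matrix $A$ is the smallest positive integer $p$ for which there is $M$ with $A^m=A^{m+p}$ for all $m\ge M$. For a digraph $D$ and positive integer $m$, the $m$-step competition graph $C^m(D)$ is the (undirected) graph on $V(D)$ in which distinct vertices $x,y$ are adjacent if and only if there is a vertex $z$ such that $D$ has a directed walk of length $m$ from $x$ to $z$ and one of length $m$ from $y$ to $z$. -}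

module Defs where

open import Data.Nat using (ℕ; zero; suc; _+_; _*_; _∸_; _≤_; _<_; _≡ᵇ_; _⊓_)
open import Data.Nat.GCD using (gcd)
open import Data.Bool using (Bool; true; false; _∧_; _∨_)
open import Data.Fin using (Fin; toℕ)
open import Data.Fin.Properties using (_≟_)
open import Data.List using (List; []; _∷_; foldr; map; concatMap; _++_)
open import Data.Bool.ListAction using (any)
open import Data.List.Relation.Unary.All using (All)
open import Data.Vec.Functional using () 
open import Data.Product using (Σ; ∃; _×_; _,_)
open import Data.Integer as ℤ using (ℤ; +_)
open import Data.Integer.Divisibility using () renaming (_∣_ to _∣ℤ_)
open import Relation.Binary.PropositionalEquality using (_≡_; _≢_)
open import Relation.Nullary using (¬_)
open import Relation.Nullary.Decidable using (⌊_⌋)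
open import Function.Bundles using (_⇔_)

-- Boolean n×n matrices, indices Fin n (vertex k ∈ Fin n stands for k+1 ∈ [n]).
BMat : ℕ → Set
BMat n = Fin n → Fin n → Bool

anyFin : (n : ℕ) → (Fin n → Bool) → Bool
anyFin zero    f = false
anyFin (suc n) f = f Fin.zero ∨ anyFin n (λ k → f (Fin.suc k))

_⊗_ : {n : ℕ} → BMat n → BMat n → BMat n
_⊗_ {n} A B i j = anyFin n (λ k → A i k ∧ B k j)

idB : (n : ℕ) → BMat n
idB n i j = ⌊ i ≟ j ⌋

_^B_ : {n : ℕ} → BMat n → ℕ → BMat n
_^B_ {n} A zero    = idB n
_^B_ {n} A (suc m) = (A ^B m) ⊗ A

_∈ᵇ_ : ℕ → List ℕ → Bool
x ∈ᵇ xs = any (λ y → x ≡ᵇ y) xs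

-- Toeplitz matrix T_n⟨S;T⟩ : entry (i,j) is 1 iff j-i ∈ S or i-j ∈ T
-- (S,T ⊆ [n-1] consist of positive integers, so j-i ∈ S forces i<j, etc.)
Toeplitz : (n : ℕ) → List ℕ → List ℕ → BMat n
Toeplitz n S T i j =
  any (λ s → (toℕ i + s) ≡ᵇ toℕ j) S ∨ any (λ t → (toℕ j + t) ≡ᵇ toℕ i) T

NonemptySubsetOf : ℕ → List ℕ → Set
NonemptySubsetOf n X = (X ≢ []) × All (λ x → 1 ≤ x × x ≤ n ∸ 1) X

gcdL : List ℕ → ℕ
gcdL = foldr gcd 0

sumset : List ℕ → List ℕ → List ℕ
sumset S T = concatMap (λ s → map (λ t → s + t) T) S

minL : List ℕ → ℕ
minL []       = 0
minL (x ∷ xs) = foldr _⊓_ x xs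

-- Digraph D(A): arc (i,j) iff A i j = 1.  Directed walks of given length.
data Walk {n : ℕ} (A : BMat n) : Fin n → Fin n → ℕ → Set where
  here : ∀ {u} → Walk A u u 0
  step : ∀ {u w v ℓ} → A u w ≡ true → Walk A w v ℓ → Walk A u v (suc ℓ)

WalkEnsured : (n : ℕ) → List ℕ → List ℕ → Set
WalkEnsured n S T =
  Σ ℕ λ M → (u v : Fin n) (ℓ : ℕ) → M ≤ ℓ →
    (+ gcdL (sumset S T)) ∣ℤ ((+ toℕ v ℤ.- + toℕ u) ℤ.- + (ℓ * minL S)) →
    Walk (Toeplitz n S T) u v ℓ

EventuallyPeriodic : {n : ℕ} → BMat n → ℕ → Set
EventuallyPeriodic A p =
  Σ ℕ λ M → (m : ℕ) → M ≤ m → ∀ i j → (A ^B m) i j ≡ (A ^B (m + p)) i j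

IsMatrixPeriod : {n : ℕ} → BMat n → ℕ → Set
IsMatrixPeriod A p =
  (0 < p) × EventuallyPeriodic A p × ((q : ℕ) → 0 < q → q < p → ¬ EventuallyPeriodic A q)

CompAdj : {n : ℕ} → BMat n → ℕ → Fin n → Fin n → Set
CompAdj {n} A m x y = (x ≢ y) × (Σ (Fin n) λ z → Walk A x z m × Walk A y z m)

CompSeqConverges : {n : ℕ} → BMat n → Set
CompSeqConverges A =
  Σ ℕ λ M → 1 ≤ M × ((m : ℕ) → M ≤ m → ∀ x y → CompAdj A m x y ⇔ CompAdj A M x y)

-- "the matrix period of A is g / h": A has matrix period p with p * h = g
-- (h = gcd(S∪T) > 0 here, so this is exactly p = g/h with exact division)
∃MatrixPeriodTimes : {n : ℕ} → BMat n → ℕ → ℕ → Set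
∃MatrixPeriodTimes A h g = Σ ℕ λ p → IsMatrixPeriod A p × (p * h ≡ g)

{-# OPTIONS --safe #-}
module Submission where

-- Every arc of D(A) moves a vertex by some s ∈ S or by −t with t ∈ T, and modulo g = gcd(S+T)
-- all of these steps are ≡ s₁, because s + t ≡ 0 ≡ s₁ + t. Hence a walk of length ℓ from u to v
-- forces v − u ≡ ℓ s₁ (mod g), and being walk-ensured is exactly the converse for ℓ ≥ M. So for
-- large m the (u,v)-entry of A^m only depends on the residue of m s₁, and since every residue is
-- some difference v − u (g < 2n), q is an eventual period iff g ∣ q s₁. As q s ≡ q s₁ and
-- q t ≡ −q s₁, this says g ∣ q x for all x ∈ S ∪ T, i.e. g ∣ q h with h = gcd(S ∪ T), i.e. g/h ∣ q.
-- Likewise, for large m distinct x, y compete in C^m(D(A)) iff x ≡ y (mod g), a condition that no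
-- longer depends on m: the common prey is a vertex in the residue class of x + m s₁, which exists
-- once g ≤ n.

open import Defs
open import Data.Nat using (ℕ; _*_; _≤_)
open import Data.List using (List; _++_)
open import Data.Product using (_×_)
open import Relation.Binary.PropositionalEquality using (_≡_)

open import Data.Bool using (Bool; true; false; _∧_; T)
open import Data.Bool.Properties using (T-∨; T-≡; ⇔→≡)
open import Data.Fin using (Fin; zero; suc; toℕ; fromℕ<)
open import Data.Fin.Properties using (_≟_; toℕ-fromℕ<)
open import Data.Integer as ℤ using (ℤ; +_; -_; _-_)
import Data.Integer.Properties as ℤ
import Data.Integer.Divisibility.Signed as ℤ
open import Data.Integer.Divisibility.Signed using (divides) renaming (_∣_ to _∣ᶻ_)
open import Data.Integer.DivMod using (_%ℕ_; _/ℕ_; a≡a%ℕn+[a/ℕn]*n; n%ℕd<d)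
open import Data.Integer.Tactic.RingSolver using (solve-∀)
open import Data.List using ([]; _∷_; map)
open import Data.List.Membership.Propositional using (_∈_; find)
open import Data.List.Membership.Propositional.Properties
  using (∈-map⁺; ∈-map⁻; ∈-concatMap⁺; ∈-concatMap⁻)
open import Data.List.Properties using (foldr-preservesᵇ; foldr-forcesᵇ)
open import Data.List.Relation.Unary.All as All using (All)
import Data.List.Relation.Unary.All.Properties as All
open import Data.List.Relation.Unary.Any as Any using (Any; here; there)
open import Data.List.Relation.Unary.Any.Properties using (any⁻)
open import Data.Nat
  using (zero; suc; _+_; _∸_; _<_; _⊓_; _≡ᵇ_; z≤n; s≤s; NonZero; >-nonZero; ≢-nonZero; ≢-nonZero⁻¹)
open import Data.Nat.Divisibility
  using (_∣_; quotient; _∣0; ∣-refl; ∣-trans; ∣⇒≤; 0∣⇒≡0; ∣m∣n⇒∣m+n; ∣m+n∣m⇒∣n; ∣n⇒∣m*n;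
         *-pres-∣; *-cancelʳ-∣)
open import Data.Nat.GCD using (gcd; gcd[m,n]∣m; gcd[m,n]∣n; gcd-greatest; c*gcd[m,n]≡gcd[cm,cn])
open import Data.Nat.Properties
  using (_<?_; ≡ᵇ⇒≡; ⊓-sel; +-comm; *-zeroʳ; *-distribˡ-+; *-distribʳ-+; ≤-trans; <-≤-trans;
         ≤-<-trans; <⇒≤; <⇒≱; <⇒≢; ≮⇒≥; n≤1+n; m≤m+n; m≤n+m; n≢0⇒n>0; +-mono-<; ∸-monoʳ-≤;
         m<n+o⇒m∸n<o; m∸n+n≡m)
open import Data.Product as Product using (∃; ∃₂; _,_; proj₁; proj₂)
open import Data.Sum as Sum using (_⊎_; inj₁; inj₂)
open import Function.Base using (_∘_; id)
open import Function.Bundles using (_⇔_; mk⇔; Equivalence)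
import Function.Properties.Equivalence as ⇔
open import Level using (0ℓ)
open import Relation.Binary.Bundles using (Setoid)
open import Relation.Binary.PropositionalEquality
  using (_≢_; refl; sym; trans; cong; subst; subst₂; module ≡-Reasoning)
import Relation.Binary.Reasoning.Setoid as ≈-Reasoning
open import Relation.Binary.Structures using (IsEquivalence)
open import Relation.Nullary using (contradiction; yes; no)
open import Relation.Nullary.Decidable using (dec-true; isYes≗does)

-- Congruence of integers modulo a natural number

-- A record rather than a plain definition, so that a and b can be inferred from a ≡ b mod g.
record _≡_mod_ (a b : ℤ) (g : ℕ) : Set where
  constructor ∣⇒≡mod
  field ≡mod⇒∣ : + g ∣ᶻ a - b

infix 4 _≡_mod_

+[m+n]-+m≡+n : ∀ m n → + (m + n) - + m ≡ + n
+[m+n]-+m≡+n m n = trans (cong (_- + m) (ℤ.pos-+ m n)) (cancel (+ m) (+ n))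
  where
  cancel : ∀ a b → (a ℤ.+ b) - a ≡ b
  cancel = solve-∀

+m-+[m+n]≡-+n : ∀ m n → + m - + (m + n) ≡ - + n
+m-+[m+n]≡-+n m n = trans (cong (λ x → + m - x) (ℤ.pos-+ m n)) (cancel (+ m) (+ n))
  where
  cancel : ∀ a b → a - (a ℤ.+ b) ≡ - b
  cancel = solve-∀

module _ {g : ℕ} where

  ≡⇒≡mod : ∀ {a b} → a ≡ b → a ≡ b mod g
  ≡⇒≡mod {a} refl = ∣⇒≡mod (divides (+ 0) (ℤ.+-inverseʳ a))

  ≡mod-sym : ∀ {a b} → a ≡ b mod g → b ≡ a mod g
  ≡mod-sym {a} {b} (∣⇒≡mod g∣a-b) = ∣⇒≡mod (subst (+ g ∣ᶻ_) (swap a b) (ℤ.∣m⇒∣-m g∣a-b))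
    where
    swap : ∀ a b → - (a - b) ≡ b - a
    swap = solve-∀

  ≡mod-trans : ∀ {a b c} → a ≡ b mod g → b ≡ c mod g → a ≡ c mod g
  ≡mod-trans {a} {b} {c} (∣⇒≡mod g∣a-b) (∣⇒≡mod g∣b-c) =
    ∣⇒≡mod (subst (+ g ∣ᶻ_) (telescope a b c) (ℤ.∣m∣n⇒∣m+n g∣a-b g∣b-c))
    where
    telescope : ∀ a b c → (a - b) ℤ.+ (b - c) ≡ a - c
    telescope = solve-∀

  ≡mod-isEquivalence : IsEquivalence (λ a b → a ≡ b mod g)
  ≡mod-isEquivalence = record { refl = ≡⇒≡mod refl ; sym = ≡mod-sym ; trans = ≡mod-trans }

  ≡mod-setoid : Setoid 0ℓ 0ℓ
  ≡mod-setoid = record { isEquivalence = ≡mod-isEquivalence }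

  +-cong-mod : ∀ {a b c d} → a ≡ b mod g → c ≡ d mod g → a ℤ.+ c ≡ b ℤ.+ d mod g
  +-cong-mod {a} {b} {c} {d} (∣⇒≡mod g∣a-b) (∣⇒≡mod g∣c-d) =
    ∣⇒≡mod (subst (+ g ∣ᶻ_) (regroup a b c d) (ℤ.∣m∣n⇒∣m+n g∣a-b g∣c-d))
    where
    regroup : ∀ a b c d → (a - b) ℤ.+ (c - d) ≡ (a ℤ.+ c) - (b ℤ.+ d)
    regroup = solve-∀

  -‿cong-mod : ∀ {a b} → a ≡ b mod g → - a ≡ - b mod g
  -‿cong-mod {a} {b} (∣⇒≡mod g∣a-b) = ∣⇒≡mod (subst (+ g ∣ᶻ_) (distrib a b) (ℤ.∣m⇒∣-m g∣a-b))
    where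
    distrib : ∀ a b → - (a - b) ≡ - a - - b
    distrib = solve-∀

  -‿cancelˡ-mod : ∀ {a b c} → a - b ≡ a - c mod g → c ≡ b mod g
  -‿cancelˡ-mod {a} {b} {c} (∣⇒≡mod g∣[a-b]-[a-c]) =
    ∣⇒≡mod (subst (+ g ∣ᶻ_) (cancel a b c) g∣[a-b]-[a-c])
    where
    cancel : ∀ a b c → (a - b) - (a - c) ≡ c - b
    cancel = solve-∀

  ≡+⇒-≡mod : ∀ {a b c} → a ≡ b ℤ.+ c mod g → a - b ≡ c mod g
  ≡+⇒-≡mod {a} {b} {c} (∣⇒≡mod g∣a-[b+c]) = ∣⇒≡mod (subst (+ g ∣ᶻ_) (regroup a b c) g∣a-[b+c])
    where
    regroup : ∀ a b c → a - (b ℤ.+ c) ≡ (a - b) - c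
    regroup = solve-∀

  m+n≡m-mod⇔∣n : ∀ m n → + (m + n) ≡ + m mod g ⇔ g ∣ n
  m+n≡m-mod⇔∣n m n =
    mk⇔ (λ (∣⇒≡mod g∣d) → ℤ.∣⇒∣ᵤ (subst (+ g ∣ᶻ_) (+[m+n]-+m≡+n m n) g∣d))
        (λ g∣n → ∣⇒≡mod (subst (+ g ∣ᶻ_) (sym (+[m+n]-+m≡+n m n)) (ℤ.∣ᵤ⇒∣ g∣n)))

  [m+n]*c≡m*c-mod⇔∣n*c : ∀ m n c → + ((m + n) * c) ≡ + (m * c) mod g ⇔ g ∣ n * c
  [m+n]*c≡m*c-mod⇔∣n*c m n c rewrite *-distribʳ-+ c m n = m+n≡m-mod⇔∣n (m * c) (n * c)

  ∣m+n⇒m≡-n-mod : ∀ {m n} → g ∣ m + n → + m ≡ - + n mod g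
  ∣m+n⇒m≡-n-mod {m} {n} g∣m+n = begin
    + m                  ≡⟨ cancel (+ m) (+ n) ⟩
    (+ m ℤ.+ + n) - + n  ≡⟨ cong (_- + n) (ℤ.pos-+ m n) ⟨
    + (m + n) - + n      ≈⟨ +-cong-mod m+n≡0 (≡⇒≡mod {a = - + n} refl) ⟩
    + 0 - + n            ≡⟨ ℤ.+-identityˡ (- + n) ⟩
    - + n                ∎
    where
    open ≈-Reasoning ≡mod-setoid
    m+n≡0 : + (m + n) ≡ + 0 mod g
    m+n≡0 = Equivalence.from (m+n≡m-mod⇔∣n 0 (m + n)) g∣m+n
    cancel : ∀ a b → a ≡ (a ℤ.+ b) - b
    cancel = solve-∀

  %ℕ-≡mod : .{{_ : NonZero g}} → ∀ a → + (a %ℕ g) ≡ a mod g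
  %ℕ-≡mod a = ∣⇒≡mod (divides (- (a /ℕ g)) (begin
    + r - a                           ≡⟨ cong (λ x → + r - x) (a≡a%ℕn+[a/ℕn]*n a g) ⟩
    + r - (+ r ℤ.+ (a /ℕ g) ℤ.* + g)  ≡⟨ cancel (+ r) (a /ℕ g) (+ g) ⟩
    - (a /ℕ g) ℤ.* + g                ∎))
    where
    open ≡-Reasoning
    r : ℕ
    r = a %ℕ g
    cancel : ∀ r q g → r - (r ℤ.+ q ℤ.* g) ≡ - q ℤ.* g
    cancel = solve-∀

-- Finite sets of naturals as lists

minL-∈ : ∀ {xs} → xs ≢ [] → minL xs ∈ xs
minL-∈ {[]}     []≢[] = contradiction refl []≢[]
minL-∈ {x ∷ xs} _     = foldr-preservesᵇ ⊓-closed (here refl) (All.tabulate there)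
  where
  ⊓-closed : ∀ {a b} → a ∈ x ∷ xs → b ∈ x ∷ xs → a ⊓ b ∈ x ∷ xs
  ⊓-closed {a} {b} a∈ b∈ with ⊓-sel a b
  ... | inj₁ a⊓b≡a rewrite a⊓b≡a = a∈
  ... | inj₂ a⊓b≡b rewrite a⊓b≡b = b∈

gcdL-∣ : ∀ xs → All (gcdL xs ∣_) xs
gcdL-∣ xs = foldr-forcesᵇ gcd-forces 0 xs ∣-refl
  where
  gcd-forces : ∀ x y → gcdL xs ∣ gcd x y → gcdL xs ∣ x × gcdL xs ∣ y
  gcd-forces x y d∣gcd = ∣-trans d∣gcd (gcd[m,n]∣m x y) , ∣-trans d∣gcd (gcd[m,n]∣n x y)

gcdL-greatest : ∀ {d} xs → All (d ∣_) xs → d ∣ gcdL xs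
gcdL-greatest {d} xs = foldr-preservesᵇ gcd-greatest (d ∣0)

*-distribˡ-gcdL : ∀ c xs → c * gcdL xs ≡ gcdL (map (c *_) xs)
*-distribˡ-gcdL c []       = *-zeroʳ c
*-distribˡ-gcdL c (x ∷ xs) =
  trans (c*gcd[m,n]≡gcd[cm,cn] c x (gcdL xs)) (cong (gcd (c * x)) (*-distribˡ-gcdL c xs))

sumset-∈ : ∀ {S T s t} → s ∈ S → t ∈ T → s + t ∈ sumset S T
sumset-∈ s∈S t∈T = ∈-concatMap⁺ _ (Any.map (λ { refl → ∈-map⁺ _ t∈T }) s∈S)

All-sumset⁺ : ∀ {P : ℕ → Set} {S T} → (∀ {s t} → s ∈ S → t ∈ T → P (s + t)) → All P (sumset S T)
All-sumset⁺ {P} P[s+t] = All.tabulate λ x∈ →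
  let s , s∈S , x∈s+T = find (∈-concatMap⁻ _ x∈)
      t , t∈T , x≡s+t = ∈-map⁻ _ x∈s+T
  in subst P (sym x≡s+t) (P[s+t] s∈S t∈T)

gcd-sumset-∣ : ∀ {S T s t} → s ∈ S → t ∈ T → gcdL (sumset S T) ∣ s + t
gcd-sumset-∣ s∈S t∈T = All.lookup (gcdL-∣ _) (sumset-∈ s∈S t∈T)

module _ {S T : List ℕ} {c t₀ : ℕ} (c∈S : c ∈ S) (t₀∈T : t₀ ∈ T) where

  private
    g : ℕ
    g = gcdL (sumset S T)

  gcd-sumset-S≡c : All (λ s → + s ≡ + c mod g) S
  gcd-sumset-S≡c = All.tabulate λ s∈S →
    ≡mod-trans (∣m+n⇒m≡-n-mod (gcd-sumset-∣ s∈S t₀∈T))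
               (≡mod-sym (∣m+n⇒m≡-n-mod (gcd-sumset-∣ c∈S t₀∈T)))

  gcd-sumset-T≡-c : All (λ t → - + t ≡ + c mod g) T
  gcd-sumset-T≡-c = All.tabulate λ t∈T → ≡mod-sym (∣m+n⇒m≡-n-mod (gcd-sumset-∣ c∈S t∈T))

  gcd-sumset-∣-multiples : ∀ {q} → g ∣ q * c → All (λ x → g ∣ q * x) (S ++ T)
  gcd-sumset-∣-multiples {q} g∣qc = All.++⁺ (All.tabulate ∣q*s) (All.tabulate ∣q*t)
    where
    ∣q*s+q*t : ∀ {s t} → s ∈ S → t ∈ T → g ∣ q * s + q * t
    ∣q*s+q*t s∈S t∈T = subst (g ∣_) (*-distribˡ-+ q _ _) (∣n⇒∣m*n q (gcd-sumset-∣ s∈S t∈T))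
    ∣q*t : ∀ {t} → t ∈ T → g ∣ q * t
    ∣q*t t∈T = ∣m+n∣m⇒∣n (∣q*s+q*t c∈S t∈T) g∣qc
    ∣q*s : ∀ {s} → s ∈ S → g ∣ q * s
    ∣q*s {s} s∈S =
      ∣m+n∣m⇒∣n (subst (g ∣_) (+-comm (q * s) (q * t₀)) (∣q*s+q*t s∈S t₀∈T)) (∣q*t t₀∈T)

-- Boolean matrix powers and walks

∧-≡true⇔ : ∀ {x y} → x ∧ y ≡ true ⇔ (x ≡ true × y ≡ true)
∧-≡true⇔ {true}  = mk⇔ (refl ,_) proj₂
∧-≡true⇔ {false} = mk⇔ (λ ()) (λ ())

anyFin-≡true⇔ : ∀ n {f : Fin n → Bool} → anyFin n f ≡ true ⇔ ∃ λ k → f k ≡ true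
anyFin-≡true⇔ zero              = mk⇔ (λ ()) (λ ())
anyFin-≡true⇔ (suc n) {f} with f zero in f0≡
... | true  = mk⇔ (λ _ → zero , f0≡) (λ _ → refl)
... | false = mk⇔ (Product.map suc id ∘ Equivalence.to (anyFin-≡true⇔ n)) from
  where
  from : ∃ (λ k → f k ≡ true) → anyFin n (f ∘ suc) ≡ true
  from (zero  , f0≡true) = contradiction (trans (sym f0≡) f0≡true) λ ()
  from (suc k , fk≡true) = Equivalence.from (anyFin-≡true⇔ n) (k , fk≡true)

module _ {n : ℕ} (A : BMat n) where

  Walk-snoc : ∀ {u w v ℓ} → Walk A u w ℓ → A w v ≡ true → Walk A u v (suc ℓ)
  Walk-snoc here          Awv = step Awv here
  Walk-snoc (step Aux W) Awv = step Aux (Walk-snoc W Awv)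

  Walk-unsnoc : ∀ {u v ℓ} → Walk A u v (suc ℓ) → ∃ λ w → Walk A u w ℓ × A w v ≡ true
  Walk-unsnoc (step Auv here)          = _ , here , Auv
  Walk-unsnoc (step Aux W@(step _ _)) =
    let w , W′ , Awv = Walk-unsnoc W in w , step Aux W′ , Awv

  ^B⇒Walk : ∀ m {i j} → (A ^B m) i j ≡ true → Walk A i j m
  ^B⇒Walk zero {i} {j} Iij≡true with i ≟ j
  ^B⇒Walk zero _  | yes refl = here
  ^B⇒Walk zero () | no _
  ^B⇒Walk (suc m) Aᵐ⁺¹ij≡true =
    let k , Aᵐik∧Akj≡true = Equivalence.to (anyFin-≡true⇔ n) Aᵐ⁺¹ij≡true
        Aᵐik≡true , Akj   = Equivalence.to ∧-≡true⇔ Aᵐik∧Akj≡true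
    in Walk-snoc (^B⇒Walk m Aᵐik≡true) Akj

  Walk⇒^B : ∀ {m i j} → Walk A i j m → (A ^B m) i j ≡ true
  Walk⇒^B {zero}  {i} here = trans (isYes≗does (i ≟ i)) (dec-true (i ≟ i) refl)
  Walk⇒^B {suc m} W =
    let k , W′ , Akj = Walk-unsnoc W
    in Equivalence.from (anyFin-≡true⇔ n) (k , Equivalence.from ∧-≡true⇔ (Walk⇒^B W′ , Akj))

  ^B≡true⇔Walk : ∀ m {i j} → (A ^B m) i j ≡ true ⇔ Walk A i j m
  ^B≡true⇔Walk m = mk⇔ (^B⇒Walk m) Walk⇒^B

IsMatrixPeriod-intro : ∀ {n} {A : BMat n} {p} → 0 < p → (∀ q → EventuallyPeriodic A q ⇔ p ∣ q) →
                       IsMatrixPeriod A p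
IsMatrixPeriod-intro {p = p} 0<p periodic⇔∣ =
  0<p , Equivalence.from (periodic⇔∣ p) ∣-refl , λ q 0<q q<p q-periodic →
    <⇒≱ q<p (∣⇒≤ {{>-nonZero 0<q}} (Equivalence.to (periodic⇔∣ q) q-periodic))

CompSeqConverges-intro : ∀ {n} {A : BMat n} (R : Fin n → Fin n → Set) M →
                         (∀ {m} → M ≤ m → ∀ x y → CompAdj A m x y ⇔ R x y) → CompSeqConverges A
CompSeqConverges-intro R M CompAdj⇔R = suc M , s≤s z≤n , λ m M<m x y →
  ⇔.trans (CompAdj⇔R (≤-trans (n≤1+n M) M<m) x y) (⇔.sym (CompAdj⇔R (n≤1+n M) x y))

-- Displacements in Toeplitz digraphs

pos : ∀ {n} → Fin n → ℤ
pos u = + toℕ u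

Toeplitz-arc : ∀ {n S T} {u w : Fin n} → Toeplitz n S T u w ≡ true →
               Any (λ s → pos w - pos u ≡ + s) S ⊎ Any (λ t → pos w - pos u ≡ - + t) T
Toeplitz-arc {u = u} {w} arc =
  Sum.map (Any.map forward ∘ any⁻ _ _) (Any.map backward ∘ any⁻ _ _)
          (Equivalence.to T-∨ (Equivalence.from T-≡ arc))
  where
  forward : ∀ {s} → T (toℕ u + s ≡ᵇ toℕ w) → pos w - pos u ≡ + s
  forward {s} u+s≡w =
    subst (λ x → + x - pos u ≡ + s) (≡ᵇ⇒≡ (toℕ u + s) (toℕ w) u+s≡w) (+[m+n]-+m≡+n (toℕ u) s)
  backward : ∀ {t} → T (toℕ w + t ≡ᵇ toℕ u) → pos w - pos u ≡ - + t
  backward {t} w+t≡u =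
    subst (λ x → pos w - + x ≡ - + t) (≡ᵇ⇒≡ (toℕ w + t) (toℕ u) w+t≡u) (+m-+[m+n]≡-+n (toℕ w) t)

module _ {n : ℕ} {S T : List ℕ} {g c : ℕ}
         (S≡c : All (λ s → + s ≡ + c mod g) S) (T≡-c : All (λ t → - + t ≡ + c mod g) T) where

  arc-displacement : ∀ {u w : Fin n} → Toeplitz n S T u w ≡ true → pos w - pos u ≡ + c mod g
  arc-displacement {u} {w} arc with Toeplitz-arc {u = u} {w} arc
  ... | inj₁ w-u≡s  = All.lookupWith (λ s≡c w-u≡s → ≡mod-trans (≡⇒≡mod w-u≡s) s≡c) S≡c w-u≡s
  ... | inj₂ w-u≡-t = All.lookupWith (λ -t≡c w-u≡-t → ≡mod-trans (≡⇒≡mod w-u≡-t) -t≡c) T≡-c w-u≡-t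

  walk-displacement : ∀ {u v ℓ} → Walk (Toeplitz n S T) u v ℓ → pos v - pos u ≡ + (ℓ * c) mod g
  walk-displacement {u} here = ≡⇒≡mod (ℤ.+-inverseʳ (pos u))
  walk-displacement {u} {v} (step {w = w} {ℓ = ℓ} arc W) = begin
    pos v - pos u                        ≡⟨ telescope (pos v) (pos w) (pos u) ⟩
    (pos v - pos w) ℤ.+ (pos w - pos u)  ≈⟨ +-cong-mod (walk-displacement W) w-u≡c ⟩
    + (ℓ * c) ℤ.+ + c                    ≡⟨ ℤ.pos-+ (ℓ * c) c ⟨
    + (ℓ * c + c)                        ≡⟨ cong +_ (+-comm (ℓ * c) c) ⟩
    + (suc ℓ * c)                        ∎
    where
    open ≈-Reasoning ≡mod-setoid
    w-u≡c : pos w - pos u ≡ + c mod g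
    w-u≡c = arc-displacement {u} {w} arc
    telescope : ∀ a b c → a - c ≡ (a - b) ℤ.+ (b - c)
    telescope = solve-∀

vertex-representative : ∀ {n g} .{{_ : NonZero g}} → g ≤ n → ∀ a →
                        ∃ λ (z : Fin n) → pos z ≡ a mod g
vertex-representative {g = g} g≤n a =
  fromℕ< r<n , ≡mod-trans (≡⇒≡mod (cong +_ (toℕ-fromℕ< r<n))) (%ℕ-≡mod a)
  where
  r<n : a %ℕ g < _
  r<n = <-≤-trans (n%ℕd<d a g) g≤n

-- The residue r of a is realised as r − 0 if r < n, and otherwise as 0 − (g − r), where g − r < n.
difference-representative : ∀ {n g} .{{_ : NonZero g}} → g < n + n → ∀ a →
                            ∃₂ λ (u v : Fin n) → pos v - pos u ≡ a mod g
difference-representative {zero}      ()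
difference-representative {suc n} {g} g<n+n a with a %ℕ g <? suc n
... | yes r<n = zero , fromℕ< r<n , (begin
  pos (fromℕ< r<n) - + 0  ≡⟨ ℤ.+-identityʳ _ ⟩
  pos (fromℕ< r<n)        ≡⟨ cong +_ (toℕ-fromℕ< r<n) ⟩
  + (a %ℕ g)              ≈⟨ %ℕ-≡mod a ⟩
  a                       ∎)
  where
  open ≈-Reasoning ≡mod-setoid
... | no r≮n = fromℕ< g∸r<n , zero , (begin
  + 0 - pos (fromℕ< g∸r<n)  ≡⟨ cong (λ x → + 0 - + x) (toℕ-fromℕ< g∸r<n) ⟩
  + 0 - + (g ∸ r)           ≈⟨ ≡+⇒-≡mod {b = + (g ∸ r)} 0≡[g∸r]+r ⟩
  + r                       ≈⟨ %ℕ-≡mod a ⟩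
  a                         ∎)
  where
  open ≈-Reasoning ≡mod-setoid
  r : ℕ
  r = a %ℕ g
  g∸r<n : g ∸ r < suc n
  g∸r<n = ≤-<-trans (∸-monoʳ-≤ g (≮⇒≥ r≮n)) (m<n+o⇒m∸n<o g (suc n) g<n+n)
  0≡[g∸r]+r : + 0 ≡ + (g ∸ r) ℤ.+ + r mod g
  0≡[g∸r]+r = begin
    + 0                ≈⟨ ≡mod-sym (Equivalence.from (m+n≡m-mod⇔∣n 0 g) ∣-refl) ⟩
    + g                ≡⟨ cong +_ (m∸n+n≡m (<⇒≤ (n%ℕd<d a g))) ⟨
    + (g ∸ r + r)      ≡⟨ ℤ.pos-+ (g ∸ r) r ⟩
    + (g ∸ r) ℤ.+ + r  ∎

-- The Toeplitz matrix T_n⟨S;T⟩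

<-of-[1,n∸1] : ∀ {n x} → 1 ≤ x × x ≤ n ∸ 1 → x < n
<-of-[1,n∸1] {zero}  (1≤x , x≤0) = contradiction (≤-trans 1≤x x≤0) λ ()
<-of-[1,n∸1] {suc n} (_ , x≤n)   = s≤s x≤n

module NonemptyToeplitz {n : ℕ} {S T : List ℕ}
                        (S-ne : NonemptySubsetOf n S) (T-ne : NonemptySubsetOf n T) where

  A : BMat n
  A = Toeplitz n S T

  g h s₁ t₀ : ℕ
  g  = gcdL (sumset S T)
  h  = gcdL (S ++ T)
  s₁ = minL S
  t₀ = minL T

  s₁∈S : s₁ ∈ S
  s₁∈S = minL-∈ (proj₁ S-ne)

  t₀∈T : t₀ ∈ T
  t₀∈T = minL-∈ (proj₁ T-ne)

  0<s₁+t₀ : 0 < s₁ + t₀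
  0<s₁+t₀ = ≤-trans (proj₁ (All.lookup (proj₂ S-ne) s₁∈S)) (m≤m+n s₁ t₀)

  g∣s₁+t₀ : g ∣ s₁ + t₀
  g∣s₁+t₀ = gcd-sumset-∣ s₁∈S t₀∈T

  instance
    g-nonZero : NonZero g
    g-nonZero = ≢-nonZero λ g≡0 → <⇒≢ 0<s₁+t₀ (sym (0∣⇒≡0 (subst (_∣ s₁ + t₀) g≡0 g∣s₁+t₀)))

  g<n+n : g < n + n
  g<n+n = ≤-<-trans (∣⇒≤ {{>-nonZero 0<s₁+t₀}} g∣s₁+t₀)
                    (+-mono-< (<-of-[1,n∸1] {n} (All.lookup (proj₂ S-ne) s₁∈S))
                              (<-of-[1,n∸1] {n} (All.lookup (proj₂ T-ne) t₀∈T)))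

  h∣S : All (h ∣_) S
  h∣S = All.++⁻ˡ S (gcdL-∣ (S ++ T))

  h∣T : All (h ∣_) T
  h∣T = All.++⁻ʳ S (gcdL-∣ (S ++ T))

  h∣g : h ∣ g
  h∣g = gcdL-greatest (sumset S T) (All-sumset⁺ λ s∈S t∈T →
          ∣m∣n⇒∣m+n (All.lookup h∣S s∈S) (All.lookup h∣T t∈T))

  instance
    h-nonZero : NonZero h
    h-nonZero = ≢-nonZero λ h≡0 → ≢-nonZero⁻¹ g (0∣⇒≡0 (subst (_∣ g) h≡0 h∣g))

  p : ℕ
  p = quotient h∣g

  g≡p*h : g ≡ p * h
  g≡p*h = _∣_.equality h∣g

  0<p : 0 < p
  0<p = n≢0⇒n>0 λ p≡0 → ≢-nonZero⁻¹ g (trans g≡p*h (cong (_* h) p≡0))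

  g∣q*s₁⇔p∣q : ∀ q → g ∣ q * s₁ ⇔ p ∣ q
  g∣q*s₁⇔p∣q q = mk⇔ to from
    where
    to : g ∣ q * s₁ → p ∣ q
    to g∣qs₁ = *-cancelʳ-∣ h (subst₂ _∣_ g≡p*h (sym (*-distribˡ-gcdL q (S ++ T))) g∣gcd[q*xs])
      where
      g∣gcd[q*xs] : g ∣ gcdL (map (q *_) (S ++ T))
      g∣gcd[q*xs] = gcdL-greatest _ (All.map⁺ (gcd-sumset-∣-multiples s₁∈S t₀∈T {q} g∣qs₁))
    from : p ∣ q → g ∣ q * s₁
    from p∣q = subst (_∣ q * s₁) (sym g≡p*h) (*-pres-∣ p∣q (All.lookup h∣S s₁∈S))

  Walk⇒displacement : ∀ {u v ℓ} → Walk A u v ℓ → pos v - pos u ≡ + (ℓ * s₁) mod g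
  Walk⇒displacement = walk-displacement (gcd-sumset-S≡c s₁∈S t₀∈T) (gcd-sumset-T≡-c s₁∈S t₀∈T)

  module _ (walk-ensured : WalkEnsured n S T) where

    M : ℕ
    M = proj₁ walk-ensured

    displacement⇒Walk : ∀ {m} → M ≤ m → ∀ {u v} → pos v - pos u ≡ + (m * s₁) mod g → Walk A u v m
    displacement⇒Walk {m} M≤m {u} {v} (∣⇒≡mod g∣d) = proj₂ walk-ensured u v m M≤m (ℤ.∣⇒∣ᵤ g∣d)

    ^B≡true⇔displacement : ∀ {m} → M ≤ m → ∀ u v →
                           (A ^B m) u v ≡ true ⇔ (pos v - pos u ≡ + (m * s₁) mod g)
    ^B≡true⇔displacement {m} M≤m u v =
      ⇔.trans (^B≡true⇔Walk A m) (mk⇔ Walk⇒displacement (displacement⇒Walk M≤m))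

    EventuallyPeriodic⇔∣ : ∀ q → EventuallyPeriodic A q ⇔ g ∣ q * s₁
    EventuallyPeriodic⇔∣ q = mk⇔ to from
      where
      to : EventuallyPeriodic A q → g ∣ q * s₁
      to (M′ , periodic) =
        let m               = M + M′
            u , v , v-u≡ms₁ = difference-representative g<n+n (+ (m * s₁))
            Aᵐuv≡true       = Equivalence.from (^B≡true⇔displacement (m≤m+n M M′) u v) v-u≡ms₁
            Aᵐ⁺quv≡true     = trans (sym (periodic m (m≤n+m M′ M) u v)) Aᵐuv≡true
            M≤m+q           = ≤-trans (m≤m+n M M′) (m≤m+n m q)
            v-u≡[m+q]s₁     = Equivalence.to (^B≡true⇔displacement M≤m+q u v) Aᵐ⁺quv≡true
        in Equivalence.to ([m+n]*c≡m*c-mod⇔∣n*c m q s₁) (≡mod-trans (≡mod-sym v-u≡[m+q]s₁) v-u≡ms₁)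
      from : g ∣ q * s₁ → EventuallyPeriodic A q
      from g∣qs₁ = M , λ m M≤m u v →
        ⇔→≡ (⇔.trans (^B≡true⇔displacement M≤m u v)
            (⇔.trans (mk⇔ (λ d → ≡mod-trans d (≡mod-sym (shift m))) (λ d → ≡mod-trans d (shift m)))
                     (⇔.sym (^B≡true⇔displacement (≤-trans M≤m (m≤m+n m q)) u v))))
        where
        shift : ∀ m → + ((m + q) * s₁) ≡ + (m * s₁) mod g
        shift m = Equivalence.from ([m+n]*c≡m*c-mod⇔∣n*c m q s₁) g∣qs₁

    CompAdj⇔≡mod : g ≤ n → ∀ {m} → M ≤ m → ∀ x y →
                   CompAdj A m x y ⇔ (x ≢ y × pos x ≡ pos y mod g)
    CompAdj⇔≡mod g≤n {m} M≤m x y = mk⇔ to from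
      where
      to : CompAdj A m x y → x ≢ y × pos x ≡ pos y mod g
      to (x≢y , z , x⇝z , y⇝z) =
        x≢y , -‿cancelˡ-mod {a = pos z}
                (≡mod-trans (Walk⇒displacement y⇝z) (≡mod-sym (Walk⇒displacement x⇝z)))
      from : x ≢ y × pos x ≡ pos y mod g → CompAdj A m x y
      from (x≢y , x≡y) =
        let z , z≡x+ms₁ = vertex-representative g≤n (pos x ℤ.+ + (m * s₁))
            z-x≡ms₁     = ≡+⇒-≡mod {b = pos x} z≡x+ms₁
            z-y≡z-x     = +-cong-mod (≡⇒≡mod {a = pos z} refl) (-‿cong-mod (≡mod-sym x≡y))
            z-y≡ms₁     = ≡mod-trans z-y≡z-x z-x≡ms₁
        in x≢y , z , displacement⇒Walk M≤m z-x≡ms₁ , displacement⇒Walk M≤m z-y≡ms₁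

theorem4p1 : (n : ℕ) (S T : List ℕ) →
    NonemptySubsetOf n S → NonemptySubsetOf n T →
    WalkEnsured n S T →
    (∃MatrixPeriodTimes (Toeplitz n S T) (gcdL (S ++ T)) (gcdL (sumset S T)))
    × (gcdL (sumset S T) ≤ n → CompSeqConverges (Toeplitz n S T))
theorem4p1 n S T S-ne T-ne walk-ensured =
  (p , IsMatrixPeriod-intro 0<p periodic⇔p∣ , sym g≡p*h) ,
  λ g≤n → CompSeqConverges-intro _ (M walk-ensured) (CompAdj⇔≡mod walk-ensured g≤n)
  where
  open NonemptyToeplitz {n} S-ne T-ne
  periodic⇔p∣ : ∀ q → EventuallyPeriodic A q ⇔ p ∣ q
  periodic⇔p∣ q = ⇔.trans (EventuallyPeriodic⇔∣ walk-ensured q) (g∣q*s₁⇔p∣q q)
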